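{- Let $\Sigma$ be an alphabet and suppose an infinite Wordle dictionary $\Delta\subseteq{}^\omega\Sigma$ can be written as a countable union $\Delta=\bigcup_{n<\omega}\Delta_n$ of dictionaries $\Delta_n\subseteq{}^\omega\Sigma$ such that, for each $n$, the codebreaker has a strategy in infinite Wordle with dictionary $\Delta_n$ that always wins at a finite stage. Then the codebreaker has a strategy in infinite Wordle with dictionary $\Delta$ that always wins at a finite stage.
   Context: Infinite Wordle: alphabet $\Sigma$, nonempty dictionary $\Delta\subseteq{}^\omega\Sigma$ of allowed codewords and guesswords. A hidden codeword $w\in\Delta$ is fixed and the codebreaker places guesswords $s_0,s_1,\dots\in\Delta$, receiving after each guess $s$ Wordle feedback: position $i$ is green if $s(i)=w(i)$; among the non-green positions of $s$ carrying letter $a$, the first $k$ are yellow where $k$ is the number of non-green positions $j$ with $w(j)=a$; the rest are gray. A strategy chooses each guess as a function of the feedback on earlier guesses; it always wins at a finite stage if for every codeword $w$ in the dictionary some guess $s_n$ with $n<\omega$ equals $w$. -}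

module Defs where

open import Data.Nat using (ℕ; zero; suc; _≤_)
open import Data.Fin using (Fin)
open import Data.List using (List; []; _∷ʳ_)
open import Data.Product using (Σ; _×_; ∃)
open import Relation.Nullary using (¬_)
open import Relation.Binary.PropositionalEquality using (_≡_)
open import Function.Definitions using (Injective)

Word : Set → Set
Word Σ = ℕ → Σ

Dictionary : Set → Set₁
Dictionary Σ = Word Σ → Set

data Colour : Set where
  green yellow gray : Colour

Feedback : Set
Feedback = ℕ → Colour

_⇔_ : Set → Set → Set
A ⇔ B = (A → B) × (B → A)

AtLeast : ℕ → (ℕ → Set) → Set
AtLeast m P = Σ (Fin m → ℕ) λ f → Injective _≡_ _≡_ f × (∀ x → P (f x))

module _ {A : Set} where

  NonGreen : (w s : Word A) → ℕ → Set
  NonGreen w s j = ¬ (s j ≡ w j)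

  -- Non-green position i of s carries letter a = s i.  Among the non-green
  -- positions of s carrying a, the first k are yellow, where k is the
  -- (possibly infinite) number of non-green positions j with w j ≡ a.
  -- Position i is among the first k iff the finite set
  --   A = {j ≤ i | j non-green, s j ≡ a}
  -- has cardinality ≤ k, i.e. every lower bound on |A| is one on k.
  YellowCond : (w s : Word A) → ℕ → Set
  YellowCond w s i =
    ∀ m → AtLeast m (λ j → (j ≤ i) × NonGreen w s j × (s j ≡ s i))
        → AtLeast m (λ j → NonGreen w s j × (w j ≡ s i))

  IsFeedback : (w s : Word A) → Feedback → Set
  IsFeedback w s c = ∀ i →
      ((c i ≡ green) ⇔ (s i ≡ w i))
    × ((c i ≡ yellow) ⇔ (NonGreen w s i × YellowCond w s i))
    × ((c i ≡ gray) ⇔ (NonGreen w s i × ¬ YellowCond w s i))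

  Strategy : Dictionary A → Set
  Strategy Δ = List Feedback → Σ (Word A) Δ

  history : (ℕ → Feedback) → ℕ → List Feedback
  history f zero = []
  history f (suc n) = history f n ∷ʳ f n

  guess : {Δ : Dictionary A} → Strategy Δ → (ℕ → Feedback) → ℕ → Word A
  guess σ f n = Data.Product.proj₁ (σ (history f n))

  IsRun : {Δ : Dictionary A} → Strategy Δ → Word A → (ℕ → Feedback) → Set
  IsRun σ w f = ∀ n → IsFeedback w (guess σ f n) (f n)

  AlwaysWinsFinite : {Δ : Dictionary A} → Strategy Δ → Set
  AlwaysWinsFinite {Δ} σ =
    ∀ w → Δ w → ∀ f → IsRun σ w f → ∃ λ n → ∀ i → guess σ f n i ≡ w i

  HasFiniteWinningStrategy : Dictionary A → Set
  HasFiniteWinningStrategy Δ = Σ (Strategy Δ) AlwaysWinsFinite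

-- Dovetail the given strategies along the Cantor pairing: stage ⟨n , j⟩ of the
-- combined play is the j-th move of the strategy for Δₙ n, computed from the
-- feedback received at the stages ⟨n , 0⟩, …, ⟨n , j - 1⟩ only, which all come
-- earlier.  Against a codeword of Δₙ n the stages ⟨n , _⟩ therefore replay a
-- genuine play of that strategy, which guesses the codeword at some finite j.
module Submission where

open import Defs
open import Data.Nat using (ℕ; zero; suc; _+_; _<_; _<′_; ≤′-refl; ≤′-step; s≤s)
open import Data.Nat.Properties
  using (+-suc; +-identityʳ; +-monoʳ-≤; m≤n+m; <-trans; <⇒<′; m≤n⇒m≤1+n; ≤-refl;
         suc-injective)
open import Data.Product using (Σ; ∃; _×_; _,_; proj₁; proj₂)
open import Data.List using (List; []; _∷_; _∷ʳ_; length; applyUpTo)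
open import Data.List.Properties using (applyUpTo-∷ʳ; length-applyUpTo)
open import Function using (_∘_)
open import Relation.Binary.PropositionalEquality
  using (_≡_; refl; sym; trans; cong; cong₂; subst; module ≡-Reasoning)

triangle : ℕ → ℕ
triangle zero    = zero
triangle (suc d) = suc d + triangle d

pair : ℕ → ℕ → ℕ
pair n j = j + triangle (n + j)

-- The inverse of pair walks the diagonals n + j = d from (d , 0) to (0 , d).
unpair : ℕ → ℕ × ℕ
unpair zero    = zero , zero
unpair (suc k) = next (unpair k)
  where
  next : ℕ × ℕ → ℕ × ℕ
  next (suc n , j) = n , suc j
  next (zero  , j) = suc j , zero

pair-sucʳ : ∀ n j → pair n (suc j) ≡ suc (pair (suc n) j)
pair-sucʳ n j = cong (λ d → suc (j + triangle d)) (+-suc n j)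

pair-sucˡ-zero : ∀ n → pair (suc n) zero ≡ suc (pair zero n)
pair-sucˡ-zero n = cong (triangle ∘ suc) (+-identityʳ n)

unpair-pair : ∀ n j → unpair (pair n j) ≡ (n , j)
unpair-pair n j = go (pair n j) n j refl
  where
  go : ∀ k n j → pair n j ≡ k → unpair k ≡ (n , j)
  go zero    zero    zero    _ = refl
  go (suc k) zero    zero    ()
  go zero    (suc n) zero    e with () ← trans (sym (pair-sucˡ-zero n)) e
  go (suc k) (suc n) zero    e
    rewrite go k zero n (suc-injective (trans (sym (pair-sucˡ-zero n)) e)) = refl
  go zero    n       (suc j) e with () ← trans (sym (pair-sucʳ n j)) e
  go (suc k) n       (suc j) e
    rewrite go k (suc n) j (suc-injective (trans (sym (pair-sucʳ n j)) e)) = refl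

pair-<-suc : ∀ n j → pair n j < pair n (suc j)
pair-<-suc n j rewrite pair-sucʳ n j =
  s≤s (+-monoʳ-≤ j (m≤n+m (triangle (n + j)) (suc (n + j))))

pair-monoʳ-< : ∀ n {i j} → i < j → pair n i < pair n j
pair-monoʳ-< n i<j = go (<⇒<′ i<j)
  where
  go : ∀ {i j} → i <′ j → pair n i < pair n j
  go {i} ≤′-refl             = pair-<-suc n i
  go {j = suc j} (≤′-step p) = <-trans (go p) (pair-<-suc n j)

nthOr : {B : Set} → B → List B → ℕ → B
nthOr d []       i       = d
nthOr d (x ∷ xs) zero    = x
nthOr d (x ∷ xs) (suc i) = nthOr d xs i

nthOr-applyUpTo : {B : Set} (d : B) (f : ℕ → B) {k i : ℕ} → i < k
  → nthOr d (applyUpTo f k) i ≡ f i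
nthOr-applyUpTo d f {suc k} {zero}  _         = refl
nthOr-applyUpTo d f {suc k} {suc i} (s≤s i<k) = nthOr-applyUpTo d (f ∘ suc) i<k

module _ {A : Set} where

  history≡applyUpTo : ∀ f k → history {A = A} f k ≡ applyUpTo f k
  history≡applyUpTo f zero    = refl
  history≡applyUpTo f (suc k) =
    trans (cong (_∷ʳ f k) (history≡applyUpTo f k)) (applyUpTo-∷ʳ f k)

  length-history : ∀ f k → length (history {A = A} f k) ≡ k
  length-history f k = trans (cong length (history≡applyUpTo f k)) (length-applyUpTo f k)

  nthOr-history : ∀ d f {k i} → i < k → nthOr d (history {A = A} f k) i ≡ f i
  nthOr-history d f {k} i<k =
    trans (cong (λ L → nthOr d L _) (history≡applyUpTo f k)) (nthOr-applyUpTo d f i<k)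

  history-cong : ∀ f g k → (∀ {i} → i < k → f i ≡ g i)
    → history {A = A} f k ≡ history {A = A} g k
  history-cong f g zero    _   = refl
  history-cong f g (suc k) f≗g =
    cong₂ _∷ʳ_ (history-cong f g k (f≗g ∘ m≤n⇒m≤1+n)) (f≗g ≤-refl)

module Dovetail {A : Set} {Δ : Dictionary A} {Δₙ : ℕ → Dictionary A}
                (Δₙ⊆Δ : ∀ n w → Δₙ n w → Δ w) (σ : ∀ n → Strategy (Δₙ n)) where

  subplay : ℕ → (ℕ → Feedback) → ℕ → Feedback
  subplay n f j = f (pair n j)

  -- Entries missing from a too-short list read as all-green feedback; such lists
  -- never occur as histories of a play, so the padding value is irrelevant.
  allGreen : Feedback
  allGreen _ = green

  move : List Feedback → ℕ × ℕ → Σ (Word A) Δ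
  move L (n , j) = proj₁ s , Δₙ⊆Δ n (proj₁ s) (proj₂ s)
    where
    s : Σ (Word A) (Δₙ n)
    s = σ n (history {A = A} (subplay n (nthOr allGreen L)) j)

  dovetail : Strategy Δ
  dovetail L = move L (unpair (length L))

  guess-dovetail : ∀ f n j → guess dovetail f (pair n j) ≡ guess (σ n) (subplay n f) j
  guess-dovetail f n j = begin
    proj₁ (move H (unpair (length H)))
      ≡⟨ cong (proj₁ ∘ move H ∘ unpair) (length-history {A = A} f (pair n j)) ⟩
    proj₁ (move H (unpair (pair n j)))
      ≡⟨ cong (proj₁ ∘ move H) (unpair-pair n j) ⟩
    proj₁ (σ n (history {A = A} (subplay n (nthOr allGreen H)) j))
      ≡⟨ cong (proj₁ ∘ σ n) (history-cong {A = A} _ _ j earlier) ⟩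
    guess (σ n) (subplay n f) j
      ∎
    where
    open ≡-Reasoning
    H : List Feedback
    H = history {A = A} f (pair n j)
    earlier : ∀ {i} → i < j → nthOr allGreen H (pair n i) ≡ f (pair n i)
    earlier i<j = nthOr-history {A = A} allGreen f (pair-monoʳ-< n i<j)

  isRun-subplay : ∀ {w f} n → IsRun dovetail w f → IsRun (σ n) w (subplay n f)
  isRun-subplay {w} {f} n run j =
    subst (λ s → IsFeedback w s (f (pair n j))) (guess-dovetail f n j) (run (pair n j))

  dovetail-alwaysWins : (∀ w → Δ w → ∃ λ n → Δₙ n w) → (∀ n → AlwaysWinsFinite (σ n))
    → AlwaysWinsFinite dovetail
  dovetail-alwaysWins Δ⊆⋃Δₙ σ-wins w w∈Δ f run
    with n , w∈Δₙ ← Δ⊆⋃Δₙ w w∈Δ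
    with j , hit ← σ-wins n w w∈Δₙ (subplay n f) (isRun-subplay n run)
    = pair n j , λ i → trans (cong (λ s → s i) (guess-dovetail f n j)) (hit i)

mainTheorem5 : (A : Set) (Δ : Dictionary A) (Δₙ : ℕ → Dictionary A)
    → (∀ w → Δ w ⇔ ∃ λ n → Δₙ n w)
    → (∀ n → HasFiniteWinningStrategy (Δₙ n))
    → HasFiniteWinningStrategy Δ
mainTheorem5 A Δ Δₙ Δ⇔⋃Δₙ winning =
  dovetail , dovetail-alwaysWins (proj₁ ∘ Δ⇔⋃Δₙ) (proj₂ ∘ winning)
  where
  open Dovetail (λ n w w∈Δₙ → proj₂ (Δ⇔⋃Δₙ w) (n , w∈Δₙ)) (proj₁ ∘ winning)
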